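{- Every $k$-probe threshold graph $G$ has a collection of $k$ independent sets $\mathbb{N}_1,\dots,\mathbb{N}_k$ such that $G$ has an embedding with respect to them which is a threshold graph and such that the collection is well-linked, i.e. for every $i=1,\dots,k$, every vertex $x \notin \mathbb{N}_i$ has a neighbor in $\mathbb{N}_i$.
   Context: A graph is a threshold graph if it has no induced subgraph isomorphic to $P_4$, $C_4$ or $2K_2$. For a graph $G=(V,E)$ and independent sets $\mathbb{N}_1,\dots,\mathbb{N}_k$ of $G$ (not necessarily disjoint), an embedding is a graph $H=(V,F)$ with $E \subseteq F$ such that every edge of $F \setminus E$ has both endpoints in some $\mathbb{N}_i$. $G$ is a $k$-probe threshold graph if for some $k$ independent sets of $G$ it has an embedding which is a threshold graph. -}

module Defs where

open import Data.Nat using (ℕ)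
open import Data.Fin using (Fin)
open import Data.Bool using (Bool; true; false)
open import Data.Product using (Σ; ∃; _×_; _,_)
open import Data.Sum using (_⊎_)
open import Relation.Nullary using (¬_)
open import Relation.Binary.PropositionalEquality using (_≡_; _≢_)

record Graph (n : ℕ) : Set where
  field
    adj   : Fin n → Fin n → Bool
    sym   : ∀ x y → adj x y ≡ adj y x
    irrefl : ∀ x → adj x x ≡ false
open Graph public

Edge : ∀ {n} → Graph n → Fin n → Fin n → Set
Edge G x y = adj G x y ≡ true

NonEdge : ∀ {n} → Graph n → Fin n → Fin n → Set
NonEdge G x y = adj G x y ≡ false

VSet : ℕ → Set
VSet n = Fin n → Bool

_∈ᵥ_ : ∀ {n} → Fin n → VSet n → Set
x ∈ᵥ S = S x ≡ true

IsIndependent : ∀ {n} → Graph n → VSet n → Set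
IsIndependent G S = ∀ x y → x ∈ᵥ S → y ∈ᵥ S → NonEdge G x y

Distinct4 : ∀ {n} → Fin n → Fin n → Fin n → Fin n → Set
Distinct4 a b c d =
  (a ≢ b) × (a ≢ c) × (a ≢ d) × (b ≢ c) × (b ≢ d) × (c ≢ d)

InducedP4 : ∀ {n} → Graph n → Fin n → Fin n → Fin n → Fin n → Set
InducedP4 G a b c d = Distinct4 a b c d ×
  Edge G a b × Edge G b c × Edge G c d ×
  NonEdge G a c × NonEdge G b d × NonEdge G a d

InducedC4 : ∀ {n} → Graph n → Fin n → Fin n → Fin n → Fin n → Set
InducedC4 G a b c d = Distinct4 a b c d ×
  Edge G a b × Edge G b c × Edge G c d × Edge G d a ×
  NonEdge G a c × NonEdge G b d

Induced2K2 : ∀ {n} → Graph n → Fin n → Fin n → Fin n → Fin n → Set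
Induced2K2 G a b c d = Distinct4 a b c d ×
  Edge G a b × Edge G c d ×
  NonEdge G a c × NonEdge G a d × NonEdge G b c × NonEdge G b d

IsThreshold : ∀ {n} → Graph n → Set
IsThreshold G = ∀ a b c d →
  ¬ InducedP4 G a b c d × ¬ InducedC4 G a b c d × ¬ Induced2K2 G a b c d

IsEmbedding : ∀ {n k} → Graph n → (Fin k → VSet n) → Graph n → Set
IsEmbedding {k = k} G N H =
  (∀ x y → Edge G x y → Edge H x y) ×
  (∀ x y → Edge H x y → NonEdge G x y →
     Σ (Fin k) λ i → (x ∈ᵥ N i) × (y ∈ᵥ N i))

HasThresholdEmbedding : ∀ {n k} → Graph n → (Fin k → VSet n) → Set
HasThresholdEmbedding G N =
  (∀ i → IsIndependent G (N i)) ×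
  Σ (Graph _) λ H → IsEmbedding G N H × IsThreshold H

IsKProbeThreshold : ∀ {n} → ℕ → Graph n → Set
IsKProbeThreshold {n} k G = Σ (Fin k → VSet n) λ N → HasThresholdEmbedding G N

WellLinked : ∀ {n k} → Graph n → (Fin k → VSet n) → Set
WellLinked G N = ∀ i x → ¬ (x ∈ᵥ N i) → ∃ λ y → (y ∈ᵥ N i) × Edge G x y

module Submission where

open import Defs
open import Data.Nat using (ℕ)
open import Data.Fin using (Fin; _≟_)
open import Data.Fin.Properties using (any?)
open import Data.Bool using (true; false; _∨_)
open import Data.Bool.Properties using () renaming (_≟_ to _≟ᵇ_)
open import Data.List using (List; []; _∷_; allFin)
open import Data.List.Relation.Unary.Any using (here; there)
open import Data.List.Membership.Propositional using (_∈_)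
open import Data.List.Membership.Propositional.Properties using (∈-allFin)
open import Data.Product using (Σ; ∃; _×_; _,_; proj₁; proj₂)
open import Data.Sum using (_⊎_; inj₁; inj₂)
open import Data.Empty using (⊥-elim)
open import Relation.Nullary using (¬_; Dec; yes; no; does)
open import Relation.Nullary.Decidable using (_×-dec_)
open import Relation.Binary.PropositionalEquality using (_≡_; refl; trans)

-- Enlarging every Nᵢ keeps H an embedding, so it suffices to grow each Nᵢ to a
-- maximal independent set of G; maximality is exactly the well-linked condition.
-- Such a set is found greedily: scan the vertices once, adding each vertex
-- that has no neighbour in the current set.

_⊆ᵥ_ : ∀ {n} → VSet n → VSet n → Set
S ⊆ᵥ T = ∀ x → x ∈ᵥ S → x ∈ᵥ T

insert : ∀ {n} → Fin n → VSet n → VSet n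
insert x S z = does (z ≟ x) ∨ S z

module _ {n : ℕ} (x : Fin n) (S : VSet n) where

  insert-self : x ∈ᵥ insert x S
  insert-self with x ≟ x
  ... | yes _ = refl
  ... | no x≢x = ⊥-elim (x≢x refl)

  insert-⊇ : S ⊆ᵥ insert x S
  insert-⊇ z z∈S with z ≟ x
  ... | yes _ = refl
  ... | no _ = z∈S

  insert-cases : ∀ z → z ∈ᵥ insert x S → z ≡ x ⊎ z ∈ᵥ S
  insert-cases z z∈ with z ≟ x
  ... | yes z≡x = inj₁ z≡x
  ... | no _ = inj₂ z∈

module _ {n : ℕ} (G : Graph n) where

  Dominated : VSet n → Fin n → Set
  Dominated S x = ∃ λ y → y ∈ᵥ S × Edge G x y

  dominated? : ∀ S x → Dec (Dominated S x)
  dominated? S x = any? λ y → (S y ≟ᵇ true) ×-dec (adj G x y ≟ᵇ true)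

  IsDominating : VSet n → Set
  IsDominating S = ∀ x → x ∈ᵥ S ⊎ Dominated S x

  nonEdge-of-undominated : ∀ {S x y} → ¬ Dominated S x → y ∈ᵥ S → NonEdge G x y
  nonEdge-of-undominated {S} {x} {y} ¬dom y∈S with adj G x y in xy
  ... | false = refl
  ... | true = ⊥-elim (¬dom (y , y∈S , xy))

  insert-independent : ∀ {S x} → IsIndependent G S → ¬ Dominated S x →
                       IsIndependent G (insert x S)
  insert-independent {S} {x} ind ¬dom a b a∈ b∈
    with insert-cases x S a a∈ | insert-cases x S b b∈
  ... | inj₁ refl | inj₁ refl = irrefl G a
  ... | inj₁ refl | inj₂ b∈S = nonEdge-of-undominated ¬dom b∈S
  ... | inj₂ a∈S | inj₁ refl = trans (Graph.sym G a b) (nonEdge-of-undominated ¬dom a∈S)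
  ... | inj₂ a∈S | inj₂ b∈S = ind a b a∈S b∈S

  addIfUndominated : (S : VSet n) (x : Fin n) → Dec (Dominated S x) → VSet n
  addIfUndominated S x (yes _) = S
  addIfUndominated S x (no _)  = insert x S

  greedy : VSet n → List (Fin n) → VSet n
  greedy S []       = S
  greedy S (x ∷ xs) = greedy (addIfUndominated S x (dominated? S x)) xs

  addIfUndominated-⊇ : ∀ S x d → S ⊆ᵥ addIfUndominated S x d
  addIfUndominated-⊇ S x (yes _) z z∈S = z∈S
  addIfUndominated-⊇ S x (no _)  z z∈S = insert-⊇ x S z z∈S

  addIfUndominated-independent : ∀ S x d → IsIndependent G S →
                                 IsIndependent G (addIfUndominated S x d)
  addIfUndominated-independent S x (yes _)   ind = ind
  addIfUndominated-independent S x (no ¬dom) ind = insert-independent ind ¬dom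

  addIfUndominated-covers : ∀ S x d →
    let T = addIfUndominated S x d in x ∈ᵥ T ⊎ Dominated T x
  addIfUndominated-covers S x (yes dom) = inj₂ dom
  addIfUndominated-covers S x (no _)    = inj₁ (insert-self x S)

  greedy-⊇ : ∀ S xs → S ⊆ᵥ greedy S xs
  greedy-⊇ S []       z z∈S = z∈S
  greedy-⊇ S (x ∷ xs) z z∈S =
    greedy-⊇ _ xs z (addIfUndominated-⊇ S x (dominated? S x) z z∈S)

  greedy-independent : ∀ S xs → IsIndependent G S → IsIndependent G (greedy S xs)
  greedy-independent S []       ind = ind
  greedy-independent S (x ∷ xs) ind =
    greedy-independent _ xs (addIfUndominated-independent S x (dominated? S x) ind)

  -- Once x is in the set or has a neighbour there, later steps only add vertices.
  greedy-covers : ∀ S xs x → x ∈ xs → x ∈ᵥ greedy S xs ⊎ Dominated (greedy S xs) x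
  greedy-covers S (x ∷ xs) x (here refl)
    with addIfUndominated-covers S x (dominated? S x)
  ... | inj₁ x∈          = inj₁ (greedy-⊇ _ xs x x∈)
  ... | inj₂ (y , y∈ , e) = inj₂ (y , greedy-⊇ _ xs y y∈ , e)
  greedy-covers S (y ∷ xs) x (there x∈xs) = greedy-covers _ xs x x∈xs

  extendToMaximalIndependent : ∀ {S} → IsIndependent G S →
    ∃ λ T → S ⊆ᵥ T × IsIndependent G T × IsDominating T
  extendToMaximalIndependent {S} ind =
    greedy S (allFin n) ,
    greedy-⊇ S (allFin n) ,
    greedy-independent S (allFin n) ind ,
    λ x → greedy-covers S (allFin n) x (∈-allFin x)

  isEmbedding-⊆ : ∀ {k} {N N′ : Fin k → VSet n} {H} →
    (∀ i → N i ⊆ᵥ N′ i) → IsEmbedding G N H → IsEmbedding G N′ H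
  isEmbedding-⊆ N⊆N′ (E⊆F , new) = E⊆F , λ x y h ne →
    let (i , x∈ , y∈) = new x y h ne in i , N⊆N′ i x x∈ , N⊆N′ i y y∈

  dominating⇒wellLinked : ∀ {k} {N : Fin k → VSet n} →
    (∀ i → IsDominating (N i)) → WellLinked G N
  dominating⇒wellLinked dom i x x∉ with dom i x
  ... | inj₁ x∈  = ⊥-elim (x∉ x∈)
  ... | inj₂ nbr = nbr

mainTheorem9 : ∀ {n} (k : ℕ) (G : Graph n) → IsKProbeThreshold k G →
    Σ (Fin k → VSet n) λ N → HasThresholdEmbedding G N × WellLinked G N
mainTheorem9 {n} k G (N , ind , H , emb , threshold) =
  N′ , (ind′ , H , isEmbedding-⊆ G {H = H} N⊆N′ emb , threshold) , dominating⇒wellLinked G dom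
  where
  maximal : ∀ i → ∃ λ T → N i ⊆ᵥ T × IsIndependent G T × IsDominating G T
  maximal i = extendToMaximalIndependent G (ind i)

  N′ : Fin k → VSet n
  N′ i = proj₁ (maximal i)

  N⊆N′ : ∀ i → N i ⊆ᵥ N′ i
  N⊆N′ i = proj₁ (proj₂ (maximal i))

  ind′ : ∀ i → IsIndependent G (N′ i)
  ind′ i = proj₁ (proj₂ (proj₂ (maximal i)))

  dom : ∀ i → IsDominating G (N′ i)
  dom i = proj₂ (proj₂ (proj₂ (maximal i)))
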